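{- Let $\rho$ be an extended deterministic conditional rewrite rule. If $\rho$ is $\mathbb{U}$-RL then it is $\mathbb{U}_{\mathrm{opt}}$-RL, and if $\rho$ is $\mathbb{U}$-NE then it is $\mathbb{U}_{\mathrm{opt}}$-NE.
   Context: $\mathrm{Var}(\cdot)$ is the set of variables occurring; a term is linear if no variable occurs twice. An extended conditional rewrite rule $\rho: l\to r\Leftarrow s_1\twoheadrightarrow t_1;\dots;s_k\twoheadrightarrow t_k$ ($k\ge0$; $l$ may be a variable) is deterministic if $\mathrm{Var}(s_i)\subseteq\mathrm{Var}(l,t_1,\dots,t_{i-1})$ for all $i$. An unconditional rule $l\to r$ is RL if $r$ is linear and NE if $\mathrm{Var}(l)\subseteq\mathrm{Var}(r)$. For $k\ge1$ let $X_i=\mathrm{Var}(l,t_1,\dots,t_{i-1})$, $Y_i=\mathrm{Var}(r,t_i,s_{i+1},t_{i+1},\dots,s_k,t_k)$, $Z_i=X_i\cap Y_i$, $\overrightarrow{X}$ a fixed listing of a finite set $X$, and $U^\rho_1,\dots,U^\rho_k$ fresh symbols. $\mathbb{U}(\rho)=\{l\to U^\rho_1(s_1,\overrightarrow{X_1})\}\cup\{U^\rho_i(t_i,\overrightarrow{X_i})\to U^\rho_{i+1}(s_{i+1},\overrightarrow{X_{i+1}})\mid1\le i<k\}\cup\{U^\rho_k(t_k,\overrightarrow{X_k})\to r\}$ and $\mathbb{U}_{\mathrm{opt}}(\rho)$ is the same with $Z_i$ in place of $X_i$; for $k=0$ both equal $\{l\to r\}$. For a rule property P and $U\in\{\mathbb{U},\mathbb{U}_{\mathrm{opt}}\}$,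 $\rho$ is $U$-P if every rule in $U(\rho)$ has P. -}

module Defs where

open import Data.Nat using (ℕ; suc)
open import Data.Nat.Properties using (_≟_)
open import Data.List using (List; []; _∷_; _++_; map; filter; deduplicate)
open import Data.List.Membership.Propositional using (_∈_)
open import Data.List.Membership.DecPropositional _≟_ using (_∈?_)
open import Data.List.Relation.Unary.All using (All)
open import Data.List.Relation.Unary.Unique.Propositional using (Unique)
open import Data.Unit using (⊤)
open import Data.Product using (_×_; _,_)
open import Data.Sum using (_⊎_; inj₁; inj₂)

-- First-order terms over a signature of function symbols Σ, variables are ℕ
-- (arities are not enforced; symbols take a list of arguments).
data Term (Σ : Set) : Set where
  var : ℕ → Term Σ
  app : Σ → List (Term Σ) → Term Σ

mutual
  vars : {Σ : Set} → Term Σ → List ℕ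
  vars (var x) = x ∷ []
  vars (app f ts) = varsL ts

  varsL : {Σ : Set} → List (Term Σ) → List ℕ
  varsL [] = []
  varsL (t ∷ ts) = vars t ++ varsL ts

_∈Var_ : {Σ : Set} → ℕ → Term Σ → Set
x ∈Var t = x ∈ vars t

Linear : {Σ : Set} → Term Σ → Set
Linear t = Unique (vars t)

Rule : Set → Set
Rule Σ = Term Σ × Term Σ

RL : {Σ : Set} → Rule Σ → Set
RL (l , r) = Linear r

NE : {Σ : Set} → Rule Σ → Set
NE (l , r) = ∀ x → x ∈Var l → x ∈Var r

-- extended conditional rewrite rule  l → r ⇐ s₁ ↠ t₁; …; sₖ ↠ tₖ
record CRule (Σ : Set) : Set where
  constructor _⇒_⇐_
  field
    lhs   : Term Σ
    rhs   : Term Σ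
    conds : List (Term Σ × Term Σ)
open CRule public

-- determinism: Var(sᵢ) ⊆ Var(l, t₁, …, tᵢ₋₁)
DetFrom : {Σ : Set} → List ℕ → List (Term Σ × Term Σ) → Set
DetFrom known [] = ⊤
DetFrom known ((s , t) ∷ cs) =
  (∀ x → x ∈Var s → x ∈ known) × DetFrom (known ++ vars t) cs

Deterministic : {Σ : Set} → CRule Σ → Set
Deterministic ρ = DetFrom (vars (lhs ρ)) (conds ρ)

varsC : {Σ : Set} → List (Term Σ × Term Σ) → List ℕ
varsC [] = []
varsC ((s , t) ∷ cs) = vars s ++ vars t ++ varsC cs

-- Unraveled rules live over the extended signature Σ ⊎ ℕ, where inj₂ i is
-- the fresh symbol Uᵢ^ρ.
embed : {Σ : Set} → Term Σ → Term (Σ ⊎ ℕ)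
embedL : {Σ : Set} → List (Term Σ) → List (Term (Σ ⊎ ℕ))
embed (var x) = var x
embed (app f ts) = app (inj₁ f) (embedL ts)
embedL [] = []
embedL (t ∷ ts) = embed t ∷ embedL ts

Uterm : {Σ : Set} → ℕ → Term Σ → List ℕ → Term (Σ ⊎ ℕ)
Uterm i u xs = app (inj₂ i) (embed u ∷ map var xs)

-- A selector computes the listing of the argument variables of Uᵢ from
-- (a list of) Xᵢ and (a list of) Yᵢ.
Selector : Set
Selector = List ℕ → List ℕ → List ℕ

selX : Selector
selX X Y = deduplicate _≟_ X

selZ : Selector
selZ X Y = filter (_∈? Y) (deduplicate _≟_ X)

-- chain step: current index i, X-list Xᵢ, current condition (sᵢ, tᵢ),
-- remaining conditions after i, and the rhs r.
chain : {Σ : Set} → Selector → Term Σ → ℕ → List ℕ →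
        Term Σ × Term Σ → List (Term Σ × Term Σ) → List (Rule (Σ ⊎ ℕ))
chain sel r i X (s , t) [] =
  (Uterm i t (sel X (vars r ++ vars t)) , embed r) ∷ []
chain sel r i X (s , t) ((s' , t') ∷ rest) =
  (Uterm i t (sel X (vars r ++ vars t ++ varsC ((s' , t') ∷ rest))) ,
   Uterm (suc i) s' (sel (X ++ vars t) (vars r ++ vars t' ++ varsC rest)))
  ∷ chain sel r (suc i) (X ++ vars t) (s' , t') rest

unravel : {Σ : Set} → Selector → CRule Σ → List (Rule (Σ ⊎ ℕ))
unravel sel (l ⇒ r ⇐ []) = (embed l , embed r) ∷ []
unravel sel (l ⇒ r ⇐ ((s , t) ∷ rest)) =
  (embed l , Uterm 1 s (sel (vars l) (vars r ++ vars t ++ varsC rest)))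
  ∷ chain sel r 1 (vars l) (s , t) rest

𝕌 : {Σ : Set} → CRule Σ → List (Rule (Σ ⊎ ℕ))
𝕌 = unravel selX

𝕌opt : {Σ : Set} → CRule Σ → List (Rule (Σ ⊎ ℕ))
𝕌opt = unravel selZ

_-_ : {Σ : Set} → (CRule Σ → List (Rule (Σ ⊎ ℕ))) → (Rule (Σ ⊎ ℕ) → Set) → CRule Σ → Set
(U - P) ρ = All P (U ρ)

module Submission where

-- The rules of 𝕌opt(ρ) are those of 𝕌(ρ) with the argument list Xᵢ of
-- every symbol Uᵢ replaced by its sublist Zᵢ = Xᵢ ∩ Yᵢ.
--
-- RL only concerns right-hand sides, which are either the embedded r or
-- Uᵢ(sᵢ, Xᵢ).  Deleting arguments from a linear term keeps it linear, so
-- RL transfers rule by rule (Linear-Uterm-selZ, chain-RL).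
--
-- NE is not rule-wise.  The variable sets X₁ ⊆ X₂ ⊆ … grow along the chain,
-- so NE of the last rule Uₖ(tₖ, Xₖ) → r of 𝕌(ρ) already gives
-- Var(l) ∪ Var(t₁) ∪ … ∪ Var(tₖ) ⊆ Var(r) (chain-NE⇒⊆rhs).  As Var(r) ⊆ Yᵢ,
-- this makes Zᵢ contain all of Xᵢ, and each rule of 𝕌opt(ρ) is NE
-- (NE-towards-selZ, NE-back-to-rhs, chain-NE).

open import Defs
open import Data.Product using (_×_; _,_; proj₁)
open import Data.Nat using (ℕ; suc)
open import Data.Nat.Properties using (_≟_)
open import Data.List using (List; []; _∷_; _++_; map; filter)
open import Data.List.Membership.Propositional using (_∈_)
open import Data.List.Membership.Propositional.Properties
  using (∈-++⁺ˡ; ∈-++⁺ʳ; ∈-++⁻; ∈-filter⁺; ∈-filter⁻; ∈-deduplicate⁺; ∈-deduplicate⁻)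
open import Data.List.Membership.DecPropositional _≟_ using (_∈?_)
open import Data.List.Relation.Binary.Subset.Propositional using (_⊆_)
open import Data.List.Relation.Unary.All using (All; []; _∷_)
import Data.List.Relation.Unary.All.Properties as All
open import Data.List.Relation.Unary.AllPairs using (_∷_)
open import Data.List.Relation.Unary.Unique.Propositional using (Unique)
import Data.List.Relation.Unary.Unique.Propositional.Properties as Unique
open import Data.Sum using (_⊎_; inj₁; inj₂)
open import Relation.Unary using (Decidable)
open import Relation.Binary.PropositionalEquality using (_≡_; refl; cong; cong₂; subst; sym)

mutual
  vars-embed : {Σ : Set} (u : Term Σ) → vars (embed u) ≡ vars u
  vars-embed (var x)    = refl
  vars-embed (app f ts) = varsL-embedL ts

  varsL-embedL : {Σ : Set} (ts : List (Term Σ)) → varsL (embedL ts) ≡ varsL ts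
  varsL-embedL []       = refl
  varsL-embedL (t ∷ ts) = cong₂ _++_ (vars-embed t) (varsL-embedL ts)

varsL-map-var : {Σ : Set} (xs : List ℕ) → varsL {Σ} (map var xs) ≡ xs
varsL-map-var []       = refl
varsL-map-var (x ∷ xs) = cong (x ∷_) (varsL-map-var xs)

vars-Uterm : {Σ : Set} (i : ℕ) (u : Term Σ) (xs : List ℕ) → vars (Uterm i u xs) ≡ vars u ++ xs
vars-Uterm {Σ} i u xs = cong₂ _++_ (vars-embed u) (varsL-map-var {Σ ⊎ ℕ} xs)

∈embed⁺ : {Σ : Set} (u : Term Σ) {x : ℕ} → x ∈ vars u → x ∈Var embed u
∈embed⁺ u = subst (_ ∈_) (sym (vars-embed u))

∈embed⁻ : {Σ : Set} (u : Term Σ) {x : ℕ} → x ∈Var embed u → x ∈ vars u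
∈embed⁻ u = subst (_ ∈_) (vars-embed u)

∈Uterm⁺ : {Σ : Set} (i : ℕ) (u : Term Σ) {xs : List ℕ} {x : ℕ} → x ∈ vars u ++ xs → x ∈Var Uterm i u xs
∈Uterm⁺ i u {xs} = subst (_ ∈_) (sym (vars-Uterm i u xs))

∈Uterm⁻ : {Σ : Set} (i : ℕ) (u : Term Σ) {xs : List ℕ} {x : ℕ} → x ∈Var Uterm i u xs → x ∈ vars u ++ xs
∈Uterm⁻ i u {xs} = subst (_ ∈_) (vars-Uterm i u xs)

∈selX⁺ : {X Y : List ℕ} {x : ℕ} → x ∈ X → x ∈ selX X Y
∈selX⁺ = ∈-deduplicate⁺ _≟_

∈selZ⁺ : {X Y : List ℕ} {x : ℕ} → x ∈ X → x ∈ Y → x ∈ selZ X Y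
∈selZ⁺ {Y = Y} x∈X x∈Y = ∈-filter⁺ (_∈? Y) (∈-deduplicate⁺ _≟_ x∈X) x∈Y

∈selZ⁻ : {X Y : List ℕ} {x : ℕ} → x ∈ selZ X Y → x ∈ X
∈selZ⁻ {X} {Y} x∈Z = ∈-deduplicate⁻ _≟_ X (proj₁ (∈-filter⁻ (_∈? Y) x∈Z))

Unique-++-filter : {A : Set} {P : A → Set} (P? : Decidable P) (as : List A) {xs : List A} →
                   Unique (as ++ xs) → Unique (as ++ filter P? xs)
Unique-++-filter P? []       u         = Unique.filter⁺ P? u
Unique-++-filter P? (a ∷ as) (a∉ ∷ u) =
  All.++⁺ (All.++⁻ˡ as a∉) (All.filter⁺ P? (All.++⁻ʳ as a∉)) ∷ Unique-++-filter P? as u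

Linear-Uterm-selZ : {Σ : Set} (i : ℕ) (u : Term Σ) (X Y Y' : List ℕ) →
                    Linear (Uterm i u (selX X Y')) → Linear (Uterm i u (selZ X Y))
Linear-Uterm-selZ i u X Y Y' lin =
  subst Unique (sym (vars-Uterm i u (selZ X Y)))
    (Unique-++-filter (_∈? Y) (vars u) (subst Unique (vars-Uterm i u (selX X Y')) lin))

chain-RL : {Σ : Set} (r : Term Σ) (i : ℕ) (X : List ℕ) (c : Term Σ × Term Σ) (rest : List (Term Σ × Term Σ)) →
           All RL (chain selX r i X c rest) → All RL (chain selZ r i X c rest)
chain-RL r i X (s , t) []                 (lin ∷ []) = lin ∷ []
chain-RL r i X (s , t) ((s' , t') ∷ rest) (lin ∷ ps) =
  Linear-Uterm-selZ (suc i) s' (X ++ vars t) Y Y lin ∷ chain-RL r (suc i) (X ++ vars t) (s' , t') rest ps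
  where Y = vars r ++ vars t' ++ varsC rest

𝕌-RL⇒𝕌opt-RL : {Σ : Set} (ρ : CRule Σ) → (𝕌 - RL) ρ → (𝕌opt - RL) ρ
𝕌-RL⇒𝕌opt-RL (l ⇒ r ⇐ [])                 p          = p
𝕌-RL⇒𝕌opt-RL (l ⇒ r ⇐ ((s , t) ∷ rest)) (lin ∷ ps) =
  Linear-Uterm-selZ 1 s (vars l) Y Y lin ∷ chain-RL r 1 (vars l) (s , t) rest ps
  where Y = vars r ++ vars t ++ varsC rest

Uterm-selX⊇ : {Σ : Set} (i : ℕ) (t : Term Σ) (X Y : List ℕ) → X ++ vars t ⊆ vars (Uterm i t (selX X Y))
Uterm-selX⊇ i t X Y {x} x∈ with ∈-++⁻ X x∈
... | inj₁ x∈X = ∈Uterm⁺ i t (∈-++⁺ʳ (vars t) (∈selX⁺ {X} {Y} x∈X))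
... | inj₂ x∈t = ∈Uterm⁺ i t {selX X Y} (∈-++⁺ˡ x∈t)

Uterm-selZ⊆ : {Σ : Set} (i : ℕ) (t : Term Σ) (X Y : List ℕ) → vars (Uterm i t (selZ X Y)) ⊆ X ++ vars t
Uterm-selZ⊆ i t X Y {x} x∈ with ∈-++⁻ (vars t) (∈Uterm⁻ i t {selZ X Y} x∈)
... | inj₁ x∈t = ∈-++⁺ʳ X x∈t
... | inj₂ x∈Z = ∈-++⁺ˡ (∈selZ⁻ {X} {Y} x∈Z)

chain-NE⇒⊆rhs : {Σ : Set} (r : Term Σ) (i : ℕ) (X : List ℕ) (s t : Term Σ) (rest : List (Term Σ × Term Σ)) →
                All NE (chain selX r i X (s , t) rest) → X ++ vars t ⊆ vars r
chain-NE⇒⊆rhs r i X s t [] (ne ∷ []) x∈ =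
  ∈embed⁻ r (ne _ (Uterm-selX⊇ i t X (vars r ++ vars t) x∈))
chain-NE⇒⊆rhs r i X s t ((s' , t') ∷ rest) (_ ∷ ps) x∈ =
  chain-NE⇒⊆rhs r (suc i) (X ++ vars t) s' t' rest ps (∈-++⁺ˡ x∈)

NE-towards-selZ : {Σ : Set} {A : List ℕ} (l : Term (Σ ⊎ ℕ)) (j : ℕ) (s r : Term Σ) (Y : List ℕ) →
                  vars l ⊆ A → A ⊆ vars r → NE (l , Uterm j s (selZ A (vars r ++ Y)))
NE-towards-selZ l j s r Y l⊆A A⊆r x x∈l =
  ∈Uterm⁺ j s (∈-++⁺ʳ (vars s) (∈selZ⁺ (l⊆A x∈l) (∈-++⁺ˡ (A⊆r (l⊆A x∈l)))))

NE-back-to-rhs : {Σ : Set} (i : ℕ) (t r : Term Σ) (X Y : List ℕ) →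
                 X ++ vars t ⊆ vars r → NE (Uterm i t (selZ X Y) , embed r)
NE-back-to-rhs i t r X Y X⊆r x x∈ = ∈embed⁺ r (X⊆r (Uterm-selZ⊆ i t X Y x∈))

chain-NE : {Σ : Set} (r : Term Σ) (i : ℕ) (X : List ℕ) (s t : Term Σ) (rest : List (Term Σ × Term Σ)) →
           All NE (chain selX r i X (s , t) rest) → All NE (chain selZ r i X (s , t) rest)
chain-NE r i X s t [] ps = NE-back-to-rhs i t r X (vars r ++ vars t) (chain-NE⇒⊆rhs r i X s t [] ps) ∷ []
chain-NE r i X s t ((s' , t') ∷ rest) ps@(_ ∷ ps') =
  NE-towards-selZ (Uterm i t (selZ X Y)) (suc i) s' r (vars t' ++ varsC rest)
    (Uterm-selZ⊆ i t X Y) (chain-NE⇒⊆rhs r i X s t ((s' , t') ∷ rest) ps)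
  ∷ chain-NE r (suc i) (X ++ vars t) s' t' rest ps'
  where Y = vars r ++ vars t ++ varsC ((s' , t') ∷ rest)

-- For the first rule l → U₁(s₁, Z₁), Var(l) = X₁ ⊆ Var(r) by chain-NE⇒⊆rhs.
𝕌-NE⇒𝕌opt-NE : {Σ : Set} (ρ : CRule Σ) → (𝕌 - NE) ρ → (𝕌opt - NE) ρ
𝕌-NE⇒𝕌opt-NE (l ⇒ r ⇐ [])                 p         = p
𝕌-NE⇒𝕌opt-NE (l ⇒ r ⇐ ((s , t) ∷ rest)) (_ ∷ ps) =
  NE-towards-selZ (embed l) 1 s r (vars t ++ varsC rest)
    (∈embed⁻ l) (λ x∈l → chain-NE⇒⊆rhs r 1 (vars l) s t rest ps (∈-++⁺ˡ x∈l))
  ∷ chain-NE r 1 (vars l) s t rest ps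

corollary3p10 : {Σ : Set} (ρ : CRule Σ) → Deterministic ρ →
    ((𝕌 - RL) ρ → (𝕌opt - RL) ρ) × ((𝕌 - NE) ρ → (𝕌opt - NE) ρ)
corollary3p10 ρ _ = 𝕌-RL⇒𝕌opt-RL ρ , 𝕌-NE⇒𝕌opt-NE ρ
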